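{- Let $n\ge 0$ be an integer and $m\in\mathbb Z$, and consider the inequality $(\mathrm{rank}_n)$: $((2n+1)\cdot x-2\cdot\mathtt f)\vee(\mathtt f-(2n+2)\cdot x)\vee(-x)\ge 0$. The following are equivalent: (1) $\mathbf Z_m\models(\mathrm{rank}_n)$; (2) $\mathbf Z_m\ltimes\mathbf Z_0\models(\mathrm{rank}_n)$; (3) $m\le n$.
   Context: $\mathbf Z_m$ is the ordered group of integers with constant $\mathtt f$ interpreted as $m$; $\mathbf Z_m\ltimes\mathbf Z_0$ is $\mathbb Z\times\mathbb Z$ with lexicographic order (first coordinate dominant) and $\mathtt f=\langle m,0\rangle$. $k\cdot t$ is the $k$-fold sum; $\models$ means the inequality holds under every evaluation. -}

module Defs where

open import Data.Nat using (ℕ; zero; suc)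
open import Data.Integer as ℤ using (ℤ; +_)
open import Data.Product using (_×_; _,_)
open import Data.Sum using (_⊎_)

data Term : Set where
  var-x : Term
  cst-f : Term
  zero′ : Term
  _⊕_   : Term → Term → Term
  ⊖_    : Term → Term
  _⊔′_  : Term → Term → Term

_·_ : ℕ → Term → Term
zero · t = zero′
suc k · t = t ⊕ (k · t)

_⊖′_ : Term → Term → Term
s ⊖′ t = s ⊕ (⊖ t)

rankTerm : ℕ → Term
rankTerm n =
  (((suc (2 Data.Nat.* n)) · var-x) ⊖′ (2 · cst-f))
    ⊔′ ((cst-f ⊖′ ((2 Data.Nat.+ 2 Data.Nat.* n) · var-x)) ⊔′ (⊖ var-x))

-- Model Z_m : integers with usual order, f ↦ m.
evalZ : ℤ → ℤ → Term → ℤ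
evalZ m a var-x = a
evalZ m a cst-f = m
evalZ m a zero′ = + 0
evalZ m a (s ⊕ t) = evalZ m a s ℤ.+ evalZ m a t
evalZ m a (⊖ t) = ℤ.- evalZ m a t
evalZ m a (s ⊔′ t) = evalZ m a s ℤ.⊔ evalZ m a t

_⊨Z_ : ℤ → Term → Set
m ⊨Z t = ∀ (a : ℤ) → + 0 ℤ.≤ evalZ m a t

-- Model Z_m ⋉ Z_0 : ℤ × ℤ, lexicographic order (first coordinate dominant), f ↦ ⟨m,0⟩.
Lex : Set
Lex = ℤ × ℤ

_≤lex_ : Lex → Lex → Set
(a₁ , a₂) ≤lex (b₁ , b₂) = (a₁ ℤ.< b₁) ⊎ ((a₁ Relation.Binary.PropositionalEquality.≡ b₁) × (a₂ ℤ.≤ b₂))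
  where import Relation.Binary.PropositionalEquality

open import Relation.Nullary using (yes; no)

_⊔lex_ : Lex → Lex → Lex
(a₁ , a₂) ⊔lex (b₁ , b₂) with a₁ ℤ.<? b₁
... | yes _ = (b₁ , b₂)
... | no _ with b₁ ℤ.<? a₁
...   | yes _ = (a₁ , a₂)
...   | no _ = (a₁ , a₂ ℤ.⊔ b₂)

evalLex : ℤ → Lex → Term → Lex
evalLex m a var-x = a
evalLex m a cst-f = (m , + 0)
evalLex m a zero′ = (+ 0 , + 0)
evalLex m a (s ⊕ t) with evalLex m a s | evalLex m a t
... | (s₁ , s₂) | (t₁ , t₂) = (s₁ ℤ.+ t₁ , s₂ ℤ.+ t₂)
evalLex m a (⊖ t) with evalLex m a t
... | (t₁ , t₂) = (ℤ.- t₁ , ℤ.- t₂)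
evalLex m a (s ⊔′ t) = evalLex m a s ⊔lex evalLex m a t

_⊨Lex_ : ℤ → Term → Set
m ⊨Lex t = ∀ (a : Lex) → (+ 0 , + 0) ≤lex evalLex m a t

-- The first projection Z_m ⋉ Z_0 → Z_m preserves all operations and f, so every inequality
-- valid in Z_m ⋉ Z_0 is valid in Z_m. If m ≤ n, the rank term at a ∈ Z_m is strictly positive
-- unless m = a = 0 (its joinand -a does it for a < 0, its joinand (2n+1)a - 2m for a > 0);
-- a strictly positive first coordinate is lexicographically positive, and on the remaining
-- slice m = a₁ = 0 the lexicographic model evaluates like Z_0 in the second coordinate.
-- If m > n, then at a = ⌊m/(n+1)⌋ ≥ 1 all three joinands are negative, since
-- (n+1)a ≤ m < (n+1)(a+1) ≤ 2(n+1)a.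
module Submission where

open import Defs
open import Data.Nat using (ℕ)
open import Data.Integer using (ℤ; +_; _≤_)
open import Data.Product using (_×_)
open import Function.Bundles using (_⇔_)

import Data.Nat as ℕ
import Data.Nat.Properties as ℕ
open import Data.Nat.DivMod using (_/_; m≡m%n+[m/n]*n; m%n<n; m/n*n≤m; m≥n⇒m/n>0)
open import Data.Nat.Tactic.RingSolver using (solve-∀)
open import Data.Integer using (-[1+_]; _<_; _+_; _-_; -_; _*_; _⊔_; _<?_; +≤+; +<+; -≤+; -<+)
import Data.Integer.Properties as ℤ
open import Data.Product using (_,_; proj₁)
open import Data.Sum using (_⊎_; inj₁; inj₂)
open import Function.Base using (_∘_)
open import Function.Bundles using (mk⇔)
open import Relation.Binary.PropositionalEquality
open import Relation.Nullary using (yes; no; contradiction)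

⊔-lub-< : ∀ {i j k} → i < k → j < k → i ⊔ j < k
⊔-lub-< {i} {j} i<k j<k with ℤ.⊔-sel i j
... | inj₁ i⊔j≡i = subst (_< _) (sym i⊔j≡i) i<k
... | inj₂ i⊔j≡j = subst (_< _) (sym i⊔j≡j) j<k

<-⊔-⊔ : ∀ {l i j k} → l < i ⊎ l < j ⊎ l < k → l < i ⊔ (j ⊔ k)
<-⊔-⊔ {i = i} {j} {k} (inj₁ l<i)        = ℤ.<-≤-trans l<i (ℤ.i≤i⊔j i (j ⊔ k))
<-⊔-⊔ {i = i} {j} {k} (inj₂ (inj₁ l<j)) = ℤ.<-≤-trans l<j (ℤ.≤-trans (ℤ.i≤i⊔j j k) (ℤ.i≤j⊔i i (j ⊔ k)))
<-⊔-⊔ {i = i} {j} {k} (inj₂ (inj₂ l<k)) = ℤ.<-≤-trans l<k (ℤ.≤-trans (ℤ.i≤j⊔i j k) (ℤ.i≤j⊔i i (j ⊔ k)))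

i<j⇒0<j-i : ∀ {i j} → i < j → + 0 < j - i
i<j⇒0<j-i {i} {j} i<j = subst (_< j - i) (ℤ.+-inverseʳ i) (ℤ.+-monoˡ-< (- i) i<j)

i<j⇒i-j<0 : ∀ {i j} → i < j → i - j < + 0
i<j⇒i-j<0 {i} {j} i<j = subst (i - j <_) (ℤ.+-inverseʳ j) (ℤ.+-monoˡ-< (- j) i<j)

evalZ-· : ∀ m a k t → evalZ m a (k · t) ≡ + k * evalZ m a t
evalZ-· m a ℕ.zero    t = sym (ℤ.*-zeroˡ (evalZ m a t))
evalZ-· m a (ℕ.suc k) t = begin
  evalZ m a t + evalZ m a (k · t) ≡⟨ cong (λ v → evalZ m a t + v) (evalZ-· m a k t) ⟩
  evalZ m a t + + k * evalZ m a t ≡⟨ ℤ.suc-* (+ k) (evalZ m a t) ⟨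
  + ℕ.suc k * evalZ m a t         ∎
  where open ≡-Reasoning

evalZ-rankTerm : ∀ n m a → evalZ m a (rankTerm n) ≡
  (+ ℕ.suc (2 ℕ.* n) * a - + 2 * m) ⊔ ((m - + (2 ℕ.+ 2 ℕ.* n) * a) ⊔ - a)
evalZ-rankTerm n m a = cong₂ _⊔_
  (cong₂ _-_ (evalZ-· m a (ℕ.suc (2 ℕ.* n)) var-x) (evalZ-· m a 2 cst-f))
  (cong (λ v → (m - v) ⊔ - a) (evalZ-· m a (2 ℕ.+ 2 ℕ.* n) var-x))

-a≤evalZ-rankTerm : ∀ n m a → - a ≤ evalZ m a (rankTerm n)
-a≤evalZ-rankTerm n m a = ℤ.≤-trans (ℤ.i≤j⊔i _ (- a)) (ℤ.i≤j⊔i _ _)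

<-evalZ-rankTerm : ∀ {l} n m a →
  l < + ℕ.suc (2 ℕ.* n) * a - + 2 * m ⊎ l < m - + (2 ℕ.+ 2 ℕ.* n) * a ⊎ l < - a →
  l < evalZ m a (rankTerm n)
<-evalZ-rankTerm {l} n m a = subst (l <_) (sym (evalZ-rankTerm n m a)) ∘ <-⊔-⊔

evalZ-rankTerm-positive⊎origin : ∀ {n m} a → m ≤ + n →
  + 0 < evalZ m a (rankTerm n) ⊎ (m ≡ + 0 × a ≡ + 0)
evalZ-rankTerm-positive⊎origin {n} {m} -[1+ k ] _ =
  inj₁ (ℤ.<-≤-trans (+<+ ℕ.z<s) (-a≤evalZ-rankTerm n m -[1+ k ]))
evalZ-rankTerm-positive⊎origin {n} {m} (+ ℕ.suc k) m≤n =
  inj₁ (<-evalZ-rankTerm n m (+ ℕ.suc k) (inj₁ (i<j⇒0<j-i 2m<[2n+1][1+k])))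
  where
  2m<[2n+1][1+k] : + 2 * m < + ℕ.suc (2 ℕ.* n) * + ℕ.suc k
  2m<[2n+1][1+k] = begin-strict
    + 2 * m                          ≤⟨ ℤ.*-monoˡ-≤-nonNeg (+ 2) m≤n ⟩
    + 2 * + n                        ≡⟨ ℤ.pos-* 2 n ⟨
    + (2 ℕ.* n)                      <⟨ +<+ (ℕ.m≤m*n (ℕ.suc (2 ℕ.* n)) (ℕ.suc k)) ⟩
    + (ℕ.suc (2 ℕ.* n) ℕ.* ℕ.suc k)  ≡⟨ ℤ.pos-* (ℕ.suc (2 ℕ.* n)) (ℕ.suc k) ⟩
    + ℕ.suc (2 ℕ.* n) * + ℕ.suc k    ∎
    where open ℤ.≤-Reasoning
evalZ-rankTerm-positive⊎origin {n} { -[1+ t ]} (+ 0) _ =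
  inj₁ (<-evalZ-rankTerm n -[1+ t ] (+ 0) (inj₁ (i<j⇒0<j-i 2m<0)))
  where
  2m<0 : + 2 * -[1+ t ] < + ℕ.suc (2 ℕ.* n) * + 0
  2m<0 = subst (_ <_) (sym (ℤ.*-zeroʳ (+ ℕ.suc (2 ℕ.* n)))) -<+
evalZ-rankTerm-positive⊎origin {n} {+ ℕ.suc t} (+ 0) _ =
  inj₁ (<-evalZ-rankTerm n (+ ℕ.suc t) (+ 0) (inj₂ (inj₁ (i<j⇒0<j-i 0<m))))
  where
  0<m : + (2 ℕ.+ 2 ℕ.* n) * + 0 < + ℕ.suc t
  0<m = subst (_< _) (sym (ℤ.*-zeroʳ (+ (2 ℕ.+ 2 ℕ.* n)))) (+<+ ℕ.z<s)
evalZ-rankTerm-positive⊎origin {m = + 0} (+ 0) _ = inj₂ (refl , refl)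

≤⇒⊨Z-rankTerm : ∀ n m → m ≤ + n → m ⊨Z rankTerm n
≤⇒⊨Z-rankTerm n m m≤n a with evalZ-rankTerm-positive⊎origin a m≤n
... | inj₁ 0<v          = ℤ.<⇒≤ 0<v
... | inj₂ (refl , refl) = -a≤evalZ-rankTerm n (+ 0) (+ 0)

[2+2n]a≡2[a[1+n]] : ∀ n a → (2 ℕ.+ 2 ℕ.* n) ℕ.* a ≡ 2 ℕ.* (a ℕ.* ℕ.suc n)
[2+2n]a≡2[a[1+n]] = solve-∀

evalZ-rankTerm-negative : ∀ n M A → 0 ℕ.< A → A ℕ.* ℕ.suc n ℕ.≤ M → M ℕ.< ℕ.suc n ℕ.+ A ℕ.* ℕ.suc n →
  evalZ (+ M) (+ A) (rankTerm n) < + 0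
evalZ-rankTerm-negative n M A 0<A A[n+1]≤M M<[A+1][n+1] =
  subst (_< + 0) (sym (evalZ-rankTerm n (+ M) (+ A)))
    (⊔-lub-< (i<j⇒i-j<0 [2n+1]A<2M) (⊔-lub-< (i<j⇒i-j<0 M<[2n+2]A) (ℤ.neg-mono-< (+<+ 0<A))))
  where
  instance
    A-nonZero : ℕ.NonZero A
    A-nonZero = ℕ.>-nonZero 0<A
  open ℕ.≤-Reasoning
  [2n+1]A<2M : + ℕ.suc (2 ℕ.* n) * + A < + 2 * + M
  [2n+1]A<2M = subst₂ _<_ (ℤ.pos-* (ℕ.suc (2 ℕ.* n)) A) (ℤ.pos-* 2 M) (+<+ (begin-strict
    ℕ.suc (2 ℕ.* n) ℕ.* A    <⟨ ℕ.*-monoˡ-< A (ℕ.n<1+n (ℕ.suc (2 ℕ.* n))) ⟩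
    (2 ℕ.+ 2 ℕ.* n) ℕ.* A    ≡⟨ [2+2n]a≡2[a[1+n]] n A ⟩
    2 ℕ.* (A ℕ.* ℕ.suc n)    ≤⟨ ℕ.*-monoʳ-≤ 2 A[n+1]≤M ⟩
    2 ℕ.* M                  ∎))
  M<[2n+2]A : + M < + (2 ℕ.+ 2 ℕ.* n) * + A
  M<[2n+2]A = subst (+ M <_) (ℤ.pos-* (2 ℕ.+ 2 ℕ.* n) A) (+<+ (begin-strict
    M                                    <⟨ M<[A+1][n+1] ⟩
    ℕ.suc n ℕ.+ A ℕ.* ℕ.suc n            ≤⟨ ℕ.+-monoˡ-≤ (A ℕ.* ℕ.suc n) (ℕ.m≤n*m (ℕ.suc n) A) ⟩
    A ℕ.* ℕ.suc n ℕ.+ A ℕ.* ℕ.suc n      ≡⟨ cong (A ℕ.* ℕ.suc n ℕ.+_) (ℕ.+-identityʳ _) ⟨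
    2 ℕ.* (A ℕ.* ℕ.suc n)                ≡⟨ [2+2n]a≡2[a[1+n]] n A ⟨
    (2 ℕ.+ 2 ℕ.* n) ℕ.* A                ∎))

⊨Z-rankTerm⇒≤ : ∀ n m → m ⊨Z rankTerm n → m ≤ + n
⊨Z-rankTerm⇒≤ n -[1+ _ ] _ = -≤+
⊨Z-rankTerm⇒≤ n (+ M) ⊨rank with M ℕ.≤? n
... | yes M≤n = +≤+ M≤n
... | no M≰n  = contradiction (⊨rank (+ A)) (ℤ.<⇒≱ (evalZ-rankTerm-negative n M A 0<A A[n+1]≤M M<[A+1][n+1]))
  where
  n<M : n ℕ.< M
  n<M = ℕ.≰⇒> M≰n
  A : ℕ
  A = M / ℕ.suc n
  0<A : 0 ℕ.< A
  0<A = m≥n⇒m/n>0 n<M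
  A[n+1]≤M : A ℕ.* ℕ.suc n ℕ.≤ M
  A[n+1]≤M = m/n*n≤m M (ℕ.suc n)
  M<[A+1][n+1] : M ℕ.< ℕ.suc n ℕ.+ A ℕ.* ℕ.suc n
  M<[A+1][n+1] = subst (ℕ._< ℕ.suc n ℕ.+ A ℕ.* ℕ.suc n) (sym (m≡m%n+[m/n]*n M (ℕ.suc n)))
    (ℕ.+-monoˡ-< (A ℕ.* ℕ.suc n) (m%n<n M (ℕ.suc n)))

proj₁-⊔lex : ∀ x y → proj₁ (x ⊔lex y) ≡ proj₁ x ⊔ proj₁ y
proj₁-⊔lex (a₁ , _) (b₁ , _) with a₁ <? b₁
... | yes a₁<b₁ = sym (ℤ.i≤j⇒i⊔j≡j (ℤ.<⇒≤ a₁<b₁))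
... | no a₁≮b₁ with b₁ <? a₁
...   | yes _ = sym (ℤ.i≥j⇒i⊔j≡i (ℤ.≮⇒≥ a₁≮b₁))
...   | no _  = sym (ℤ.i≥j⇒i⊔j≡i (ℤ.≮⇒≥ a₁≮b₁))

proj₁-evalLex : ∀ m a t → proj₁ (evalLex m a t) ≡ evalZ m (proj₁ a) t
proj₁-evalLex m a var-x = refl
proj₁-evalLex m a cst-f = refl
proj₁-evalLex m a zero′ = refl
proj₁-evalLex m a (s ⊕ t) with evalLex m a s | proj₁-evalLex m a s | evalLex m a t | proj₁-evalLex m a t
... | _ , _ | refl | _ , _ | refl = refl
proj₁-evalLex m a (⊖ t) with evalLex m a t | proj₁-evalLex m a t
... | _ , _ | refl = refl
proj₁-evalLex m a (s ⊔′ t) =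
  trans (proj₁-⊔lex (evalLex m a s) (evalLex m a t)) (cong₂ _⊔_ (proj₁-evalLex m a s) (proj₁-evalLex m a t))

evalLex-f≡0 : ∀ b t → evalLex (+ 0) (+ 0 , b) t ≡ (+ 0 , evalZ (+ 0) b t)
evalLex-f≡0 b var-x = refl
evalLex-f≡0 b cst-f = refl
evalLex-f≡0 b zero′ = refl
evalLex-f≡0 b (s ⊕ t) rewrite evalLex-f≡0 b s | evalLex-f≡0 b t = refl
evalLex-f≡0 b (⊖ t) rewrite evalLex-f≡0 b t = refl
evalLex-f≡0 b (s ⊔′ t) rewrite evalLex-f≡0 b s | evalLex-f≡0 b t = refl

0≤lex⇒0≤proj₁ : ∀ v → (+ 0 , + 0) ≤lex v → + 0 ≤ proj₁ v
0≤lex⇒0≤proj₁ v (inj₁ 0<v₁)      = ℤ.<⇒≤ 0<v₁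
0≤lex⇒0≤proj₁ v (inj₂ (0≡v₁ , _)) = ℤ.≤-reflexive 0≡v₁

⊨Lex⇒⊨Z : ∀ m t → m ⊨Lex t → m ⊨Z t
⊨Lex⇒⊨Z m t ⊨t a = subst (+ 0 ≤_) (proj₁-evalLex m (a , + 0) t) (0≤lex⇒0≤proj₁ _ (⊨t (a , + 0)))

≤⇒⊨Lex-rankTerm : ∀ n m → m ≤ + n → m ⊨Lex rankTerm n
≤⇒⊨Lex-rankTerm n m m≤n (a₁ , a₂) with evalZ-rankTerm-positive⊎origin a₁ m≤n
... | inj₁ 0<v₁ = inj₁ (subst (+ 0 <_) (sym (proj₁-evalLex m (a₁ , a₂) (rankTerm n))) 0<v₁)
... | inj₂ (refl , refl) rewrite evalLex-f≡0 a₂ (rankTerm n) = inj₂ (refl , ≤⇒⊨Z-rankTerm n (+ 0) m≤n a₂)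

lemma5p4 : (n : ℕ) (m : ℤ) →
    ((m ⊨Z rankTerm n) ⇔ (m ⊨Lex rankTerm n)) ×
    ((m ⊨Lex rankTerm n) ⇔ (m ≤ + n))
lemma5p4 n m =
  mk⇔ (≤⇒⊨Lex-rankTerm n m ∘ ⊨Z-rankTerm⇒≤ n m) (⊨Lex⇒⊨Z m (rankTerm n)) ,
  mk⇔ (⊨Z-rankTerm⇒≤ n m ∘ ⊨Lex⇒⊨Z m (rankTerm n)) (≤⇒⊨Lex-rankTerm n m)
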